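{- The rank-two Weil operator satisfies $$\operatorname{O}^{(2)}_{\mathfrak{f}}(X_1,X_2)=\sum_{j=1}^{n}a_j\sum_{\alpha+\beta=j-1}X_1^\alpha X_2^\beta=\sum_{k=0}^{n-1}X_1^k\operatorname{D}_{\mathfrak{f}}(X_2^k).$$ In general, for $r\ge2$, $$\operatorname{O}^{(r)}_{\mathfrak{f}}(X_1,\dots,X_r)\equiv\sum_{0\le j_1,\dots,j_{r-1}<n}X_1^{j_1}\cdots X_{r-1}^{j_{r-1}}\operatorname{D}_{\mathfrak{f}}(X_r^{j_1})\cdots\operatorname{D}_{\mathfrak{f}}(X_r^{j_{r-1}})\equiv\sum_{0\le j_1,\dots,j_{r-1}<n}\operatorname{D}_{\mathfrak{f}}(X_1^{j_1})\cdots\operatorname{D}_{\mathfrak{f}}(X_{r-1}^{j_{r-1}})X_r^{j_1+\cdots+j_{r-1}}$$ modulo $\mathfrak{f}(X_r)$.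
   Context: Let $\mathbb{F}_q$ be a finite field and $\mathfrak{f}(t)=a_nt^n+\cdots+a_0\in\mathbb{F}_q[t]$ monic ($a_n=1$) of degree $n\ge1$. For a variable $X$, $\operatorname{D}_{\mathfrak{f}}$ is the $\mathbb{F}_q$-linear map on polynomials in $X$ of degree $<n$ with $\operatorname{D}_{\mathfrak{f}}(X^i)=\sum_{j=0}^{n-i-1}a_{i+j+1}X^j$ for $0\le i\le n-1$. Weil operators: $\operatorname{O}^{(1)}_{\mathfrak{f}}(X_1)=1$; $\operatorname{O}^{(2)}_{\mathfrak{f}}(X_1,X_2)=\sum_{k=0}^{n-1}\operatorname{D}_{\mathfrak{f}}(X_1^k)X_2^k$; for $r>2$, $\operatorname{O}^{(r)}_{\mathfrak{f}}(X_1,\dots,X_r)$ is the unique polynomial in $\mathbb{F}_q[X_1,\dots,X_r]$ whose degree in each $X_i$ is $<n$ and which is congruent to $\prod_{j=1}^{r-1}\operatorname{O}^{(2)}_{\mathfrak{f}}(X_j,X_r)$ modulo $\mathfrak{f}(X_r)$. -}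

module Defs where

open import Level using (_⊔_; Lift)
open import Algebra.Bundles using (CommutativeRing)
open import Data.Nat as ℕ using (ℕ; zero; suc; _∸_)
open import Data.Fin as Fin using (Fin; toℕ; inject₁; fromℕ)
open import Data.List using (List; []; _∷_; map; upTo; drop; length)
open import Data.List.Relation.Unary.All using (All)
open import Data.Product using (Σ; ∃; _×_)
open import Relation.Nullary using (¬_)
open import Data.Unit using (⊤)
open import Function.Bundles using (Inverse)
import Relation.Binary.PropositionalEquality as P

module _ {c ℓ} (F : CommutativeRing c ℓ) where
  open CommutativeRing F hiding (zero)

  IsField : Set (c ⊔ ℓ)
  IsField = (¬ (1# ≈ 0#)) × (∀ x → ¬ (x ≈ 0#) → ∃ λ y → x * y ≈ 1#)

  IsFinite : Set (c ⊔ ℓ)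
  IsFinite = ∃ λ (q : ℕ) → Inverse setoid (P.setoid (Fin q))

  IsFiniteField : Set (c ⊔ ℓ)
  IsFiniteField = IsField × IsFinite

-- Multivariate polynomials over F, in r variables X₁,…,X_r
-- (indexed by Fin r: X_{i+1} is `var i`).
-- Pol 0 ≅ F ; Pol (suc r) ≅ lists of coefficients in Pol r, i.e.
-- polynomials in the outermost variable X₁ (list index = exponent of X₁)
-- with coefficients polynomials in X₂,…,X_{r+1}.
-- Equality is up to trailing zeros: p ≈P q iff p - q is the zero polynomial.

module Poly {c ℓ} (F : CommutativeRing c ℓ) where
  open CommutativeRing F renaming (Carrier to K) hiding (zero)

  data Pol : ℕ → Set c where
    κ : K → Pol zero
    ⟨_⟩ : ∀ {r} → List (Pol r) → Pol (suc r)

  IsZero : ∀ {r} → Pol r → Set (c ⊔ ℓ)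
  IsZeroL : ∀ {r} → List (Pol r) → Set (c ⊔ ℓ)
  IsZero (κ x) = Lift c (x ≈ 0#)
  IsZero ⟨ xs ⟩ = IsZeroL xs
  IsZeroL [] = Lift (c ⊔ ℓ) ⊤
  IsZeroL (x ∷ xs) = IsZero x × IsZeroL xs

  const : ∀ {r} → K → Pol r
  const {zero} x = κ x
  const {suc r} x = ⟨ const {r} x ∷ [] ⟩

  0P 1P : ∀ {r} → Pol r
  0P = const 0#
  1P = const 1#

  infixl 6 _+P_ _-P_
  infixl 7 _*P_
  infix 4 _≈P_

  _+P_ : ∀ {r} → Pol r → Pol r → Pol r
  addL : ∀ {r} → List (Pol r) → List (Pol r) → List (Pol r)
  κ x +P κ y = κ (x + y)
  ⟨ xs ⟩ +P ⟨ ys ⟩ = ⟨ addL xs ys ⟩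
  addL [] ys = ys
  addL (x ∷ xs) [] = x ∷ xs
  addL (x ∷ xs) (y ∷ ys) = (x +P y) ∷ addL xs ys

  -P_ : ∀ {r} → Pol r → Pol r
  negL : ∀ {r} → List (Pol r) → List (Pol r)
  -P (κ x) = κ (- x)
  -P ⟨ xs ⟩ = ⟨ negL xs ⟩
  negL [] = []
  negL (x ∷ xs) = (-P x) ∷ negL xs

  _-P_ : ∀ {r} → Pol r → Pol r → Pol r
  p -P q = p +P (-P q)

  _*P_ : ∀ {r} → Pol r → Pol r → Pol r
  mulL : ∀ {r} → List (Pol r) → List (Pol r) → List (Pol r)
  scaleL : ∀ {r} → Pol r → List (Pol r) → List (Pol r)
  κ x *P κ y = κ (x * y)
  ⟨ xs ⟩ *P ⟨ ys ⟩ = ⟨ mulL xs ys ⟩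
  scaleL a [] = []
  scaleL a (y ∷ ys) = (a *P y) ∷ scaleL a ys
  -- (a + X₁·p)·q = a·q + X₁·(p·q)
  mulL [] ys = []
  mulL (x ∷ xs) ys = addL (scaleL x ys) (0P ∷ mulL xs ys)

  _≈P_ : ∀ {r} → Pol r → Pol r → Set (c ⊔ ℓ)
  p ≈P q = IsZero (p -P q)

  _^P_ : ∀ {r} → Pol r → ℕ → Pol r
  p ^P zero = 1P
  p ^P suc k = p *P (p ^P k)

  var : ∀ {r} → Fin r → Pol r
  var {suc r} Fin.zero = ⟨ 0P ∷ 1P ∷ [] ⟩
  var {suc r} (Fin.suc i) = ⟨ var i ∷ [] ⟩

  sumℕ : ∀ {r} → ℕ → (ℕ → Pol r) → Pol r
  sumℕ zero g = 0P
  sumℕ (suc m) g = sumℕ m g +P g m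

  sumFin : ∀ {r} (m : ℕ) → (Fin m → Pol r) → Pol r
  sumFin zero g = 0P
  sumFin (suc m) g = g Fin.zero +P sumFin m (λ i → g (Fin.suc i))

  prodFin : ∀ {r} (m : ℕ) → (Fin m → Pol r) → Pol r
  prodFin zero g = 1P
  prodFin (suc m) g = g Fin.zero *P prodFin m (λ i → g (Fin.suc i))

  sumℕFin : (m : ℕ) → (Fin m → ℕ) → ℕ
  sumℕFin zero g = 0
  sumℕFin (suc m) g = g Fin.zero ℕ.+ sumℕFin m (λ i → g (Fin.suc i))

  sumTuples : ∀ {r} (m n : ℕ) → ((Fin m → Fin n) → Pol r) → Pol r
  sumTuples zero n G = G (λ ())
  sumTuples (suc m) n G =
    sumFin n (λ j → sumTuples m n (λ js → G (λ { Fin.zero → j ; (Fin.suc i) → js i })))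

  -- univariate polynomials over F (coefficient lists, a_i at index i)
  UPol : Set c
  UPol = List K

  coeff : UPol → ℕ → K
  coeff [] i = 0#
  coeff (a ∷ as) zero = a
  coeff (a ∷ as) (suc i) = coeff as i

  evalU : ∀ {r} → UPol → Pol r → Pol r
  evalU [] x = 0P
  evalU (a ∷ as) x = const a +P x *P evalU as x

  IsMonicOfDegree : UPol → ℕ → Set ℓ
  IsMonicOfDegree f n = (length f P.≡ suc n) × (coeff f n ≈ 1#)

  -- D_𝔣(X^i) = Σ_{j=0}^{n-i-1} a_{i+j+1} X^j  (for 0 ≤ i ≤ n-1), n = deg 𝔣
  D-mono : UPol → ℕ → ℕ → UPol
  D-mono f n i = map (λ j → coeff f (i ℕ.+ j ℕ.+ 1)) (upTo (n ∸ i))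

  Dvar : ∀ {r} → UPol → ℕ → Fin r → ℕ → Pol r
  Dvar f n l i = evalU (D-mono f n i) (var l)

  O2At : ∀ {r} → UPol → ℕ → Fin r → Fin r → Pol r
  O2At f n i l = sumℕ n (λ k → Dvar f n i k *P (var l ^P k))

  DegLt : ∀ {r} → Fin r → ℕ → Pol r → Set (c ⊔ ℓ)
  DegLt {suc r} Fin.zero n ⟨ ps ⟩ = All IsZero (drop n ps)
  DegLt {suc r} (Fin.suc i) n ⟨ ps ⟩ = All (DegLt i n) ps

  _≡_mod_ : ∀ {r} → Pol r → Pol r → Pol r → Set (c ⊔ ℓ)
  p ≡ q mod g = ∃ λ h → (p -P q) ≈P g *P h

-- Expanding D_𝔣(x^k) = Σ_{j<n-k} a_{k+j+1} x^j and regrouping the double sum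
-- Σ_k Σ_j a_{k+j+1} x^j y^k along the antidiagonals k + j = J gives the diagonal form
-- Σ_J a_{J+1} Σ_{α+β=J} x^α y^β, which is symmetric in x and y; hence O⁽²⁾(x, y) = O⁽²⁾(y, x).
-- The rank-r identities hold exactly for the product ∏_l O⁽²⁾(X_l, X_r), before any reduction
-- modulo 𝔣(X_r): multiply out the product of sums over all tuples (j_1, …, j_{r-1}), writing
-- each factor by the symmetric form or by the definition. They therefore pass to every O
-- congruent to that product. No other hypothesis is needed (F may be any commutative ring),
-- so the remaining ones are left unused.

module Submission where

open import Defs
open import Level using (Level; _⊔_; Lift; lift)
open import Algebra.Bundles using (CommutativeRing)
open import Algebra.Structures using (IsCommutativeRing)
open import Data.Nat as ℕ using (ℕ; zero; suc; _∸_; _≤_; _<_; s≤s⁻¹)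
open import Data.Nat.Properties
  using (m<n⇒m<1+n; n<1+n; n∸n≡0; +-∸-assoc; m∸n+n≡m; m∸[m∸n]≡n) renaming (+-comm to ℕ-+-comm)
open import Data.Fin as Fin using (Fin; toℕ; inject₁; fromℕ)
open import Data.List using (List; []; _∷_; applyUpTo)
open import Data.List.Properties using (map-upTo)
open import Data.Product using (_×_; _,_)
open import Function using (_∘_)
open import Relation.Binary.Structures using (IsEquivalence)
import Relation.Binary.PropositionalEquality as Eq
import Relation.Binary.Reasoning.Setoid as SetoidReasoning
import Algebra.Properties.CommutativeSemigroup as CommutativeSemigroupProperties
import Algebra.Properties.Group as GroupProperties

module PolynomialRing {c ℓ} (F : CommutativeRing c ℓ) where
  open Poly F
  private module F = CommutativeRing F

  coeffAt : ∀ {r} → List (Pol r) → ℕ → Pol r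
  coeffAt [] i = 0P
  coeffAt (x ∷ xs) zero = x
  coeffAt (x ∷ xs) (suc i) = coeffAt xs i

  -- Coefficientwise equality, comparing coefficient lists up to trailing zeros. The ring
  -- laws are proved for it and transferred to _≈P_ by ≈P⇒≋ and ≋⇒≈P.
  infix 4 _≋_ _≋ₗ_
  _≋_ : ∀ {r} → Pol r → Pol r → Set (c ⊔ ℓ)
  record _≋ₗ_ {r} (xs ys : List (Pol r)) : Set (c ⊔ ℓ)

  κ x ≋ κ y = Lift c (x F.≈ y)
  ⟨ xs ⟩ ≋ ⟨ ys ⟩ = xs ≋ₗ ys

  -- A record rather than a function, so that the mutual definition is structurally
  -- recursive and the lists can be inferred from a proof.
  record _≋ₗ_ xs ys where
    inductive
    constructor coeffwise
    field coeffAt-cong : ∀ i → coeffAt xs i ≋ coeffAt ys i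

  open _≋ₗ_ public

  IsPolynomialRing : ℕ → Set (c ⊔ ℓ)
  IsPolynomialRing r = IsCommutativeRing (_≋_ {r}) _+P_ _*P_ -P_ 0P 1P

  toCommutativeRing : ∀ {r} → IsPolynomialRing r → CommutativeRing c (c ⊔ ℓ)
  toCommutativeRing {r} isCR = record
    { Carrier = Pol r ; _≈_ = _≋_ ; _+_ = _+P_ ; _*_ = _*P_ ; -_ = -P_
    ; 0# = 0P ; 1# = 1P ; isCommutativeRing = isCR }

  κ-isPolynomialRing : IsPolynomialRing 0
  κ-isPolynomialRing = record
    { isRing = record
      { +-isAbelianGroup = record
        { isGroup = record
          { isMonoid = record
            { isSemigroup = record
              { isMagma = record
                { isEquivalence = record
                  { refl = λ { {κ x} → lift F.refl }
                  ; sym = λ { {κ x} {κ y} (lift p) → lift (F.sym p) }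
                  ; trans = λ { {κ x} {κ y} {κ z} (lift p) (lift q) → lift (F.trans p q) } }
                ; ∙-cong = λ { {κ x} {κ y} {κ u} {κ v} (lift p) (lift q) →
                               lift (F.+-cong p q) } }
              ; assoc = λ { (κ x) (κ y) (κ z) → lift (F.+-assoc x y z) } }
            ; identity = (λ { (κ x) → lift (F.+-identityˡ x) })
                       , (λ { (κ x) → lift (F.+-identityʳ x) }) }
          ; inverse = (λ { (κ x) → lift (F.-‿inverseˡ x) })
                    , (λ { (κ x) → lift (F.-‿inverseʳ x) })
          ; ⁻¹-cong = λ { {κ x} {κ y} (lift p) → lift (F.-‿cong p) } }
        ; comm = λ { (κ x) (κ y) → lift (F.+-comm x y) } }
      ; *-cong = λ { {κ x} {κ y} {κ u} {κ v} (lift p) (lift q) → lift (F.*-cong p q) }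
      ; *-assoc = λ { (κ x) (κ y) (κ z) → lift (F.*-assoc x y z) }
      ; *-identity = (λ { (κ x) → lift (F.*-identityˡ x) })
                   , (λ { (κ x) → lift (F.*-identityʳ x) })
      ; distrib = (λ { (κ x) (κ y) (κ z) → lift (F.distribˡ x y z) })
                , (λ { (κ x) (κ y) (κ z) → lift (F.distribʳ x y z) })
      }
    ; *-comm = λ { (κ x) (κ y) → lift (F.*-comm x y) } }

  module CoefficientLists {r} (isCR : IsPolynomialRing r) where
    open CommutativeRing (toCommutativeRing isCR) hiding (zero)
    open CommutativeSemigroupProperties +-commutativeSemigroup using (interchange)
    open GroupProperties +-group using (ε⁻¹≈ε)
    open SetoidReasoning setoid

    ≋ₗ-isEquivalence : IsEquivalence _≋ₗ_
    ≋ₗ-isEquivalence = record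
      { refl = coeffwise λ i → refl
      ; sym = λ p → coeffwise λ i → sym (coeffAt-cong p i)
      ; trans = λ p q → coeffwise λ i → trans (coeffAt-cong p i) (coeffAt-cong q i) }

    open IsEquivalence ≋ₗ-isEquivalence public
      using () renaming (refl to ≋ₗ-refl; sym to ≋ₗ-sym; trans to ≋ₗ-trans)

    ∷-cong : ∀ {x y xs ys} → x ≈ y → xs ≋ₗ ys → x ∷ xs ≋ₗ y ∷ ys
    ∷-cong x≈y xs≈ys = coeffwise λ { zero → x≈y ; (suc i) → coeffAt-cong xs≈ys i }

    [0P]≋ₗ[] : 0P {r} ∷ [] ≋ₗ []
    [0P]≋ₗ[] = coeffwise λ { zero → refl ; (suc i) → refl }

    coeffAt-addL : ∀ xs ys i → coeffAt (addL xs ys) i ≈ coeffAt xs i + coeffAt ys i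
    coeffAt-addL [] ys i = sym (+-identityˡ _)
    coeffAt-addL (x ∷ xs) [] i = sym (+-identityʳ _)
    coeffAt-addL (x ∷ xs) (y ∷ ys) zero = refl
    coeffAt-addL (x ∷ xs) (y ∷ ys) (suc i) = coeffAt-addL xs ys i

    coeffAt-negL : ∀ xs i → coeffAt (negL xs) i ≈ - coeffAt xs i
    coeffAt-negL [] i = sym ε⁻¹≈ε
    coeffAt-negL (x ∷ xs) zero = refl
    coeffAt-negL (x ∷ xs) (suc i) = coeffAt-negL xs i

    coeffAt-scaleL : ∀ a ys i → coeffAt (scaleL a ys) i ≈ a * coeffAt ys i
    coeffAt-scaleL a [] i = sym (zeroʳ a)
    coeffAt-scaleL a (y ∷ ys) zero = refl
    coeffAt-scaleL a (y ∷ ys) (suc i) = coeffAt-scaleL a ys i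

    addL-cong : ∀ {xs xs′ ys ys′} → xs ≋ₗ xs′ → ys ≋ₗ ys′ → addL xs ys ≋ₗ addL xs′ ys′
    addL-cong {xs} {xs′} {ys} {ys′} p q = coeffwise λ i →
      trans (coeffAt-addL xs ys i)
            (trans (+-cong (coeffAt-cong p i) (coeffAt-cong q i)) (sym (coeffAt-addL xs′ ys′ i)))

    addL-assoc : ∀ xs ys zs → addL (addL xs ys) zs ≋ₗ addL xs (addL ys zs)
    addL-assoc xs ys zs = coeffwise λ i → begin
      coeffAt (addL (addL xs ys) zs) i                    ≈⟨ coeffAt-addL (addL xs ys) zs i ⟩
      coeffAt (addL xs ys) i + coeffAt zs i               ≈⟨ +-congʳ (coeffAt-addL xs ys i) ⟩
      coeffAt xs i + coeffAt ys i + coeffAt zs i          ≈⟨ +-assoc _ _ _ ⟩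
      coeffAt xs i + (coeffAt ys i + coeffAt zs i)        ≈⟨ +-congˡ (coeffAt-addL ys zs i) ⟨
      coeffAt xs i + coeffAt (addL ys zs) i               ≈⟨ coeffAt-addL xs (addL ys zs) i ⟨
      coeffAt (addL xs (addL ys zs)) i                    ∎

    addL-comm : ∀ xs ys → addL xs ys ≋ₗ addL ys xs
    addL-comm xs ys = coeffwise λ i →
      trans (coeffAt-addL xs ys i) (trans (+-comm _ _) (sym (coeffAt-addL ys xs i)))

    addL-interchange : ∀ ws xs ys zs →
      addL (addL ws xs) (addL ys zs) ≋ₗ addL (addL ws ys) (addL xs zs)
    addL-interchange ws xs ys zs = coeffwise λ i → begin
      coeffAt (addL (addL ws xs) (addL ys zs)) i
        ≈⟨ trans (coeffAt-addL (addL ws xs) (addL ys zs) i)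
                 (+-cong (coeffAt-addL ws xs i) (coeffAt-addL ys zs i)) ⟩
      (coeffAt ws i + coeffAt xs i) + (coeffAt ys i + coeffAt zs i)
        ≈⟨ interchange _ _ _ _ ⟩
      (coeffAt ws i + coeffAt ys i) + (coeffAt xs i + coeffAt zs i)
        ≈⟨ trans (coeffAt-addL (addL ws ys) (addL xs zs) i)
                 (+-cong (coeffAt-addL ws ys i) (coeffAt-addL xs zs i)) ⟨
      coeffAt (addL (addL ws ys) (addL xs zs)) i ∎

    addL-identityʳ : ∀ xs → addL xs [] ≋ₗ xs
    addL-identityʳ xs = coeffwise λ i → trans (coeffAt-addL xs [] i) (+-identityʳ _)

    negL-cong : ∀ {xs ys} → xs ≋ₗ ys → negL xs ≋ₗ negL ys
    negL-cong {xs} {ys} p = coeffwise λ i →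
      trans (coeffAt-negL xs i) (trans (-‿cong (coeffAt-cong p i)) (sym (coeffAt-negL ys i)))

    negL-inverseˡ : ∀ xs → addL (negL xs) xs ≋ₗ 0P ∷ []
    negL-inverseˡ xs = coeffwise λ i → begin
      coeffAt (addL (negL xs) xs) i      ≈⟨ coeffAt-addL (negL xs) xs i ⟩
      coeffAt (negL xs) i + coeffAt xs i ≈⟨ +-congʳ (coeffAt-negL xs i) ⟩
      - coeffAt xs i + coeffAt xs i      ≈⟨ -‿inverseˡ _ ⟩
      0P                                 ≈⟨ coeffAt-cong [0P]≋ₗ[] i ⟨
      coeffAt (0P ∷ []) i                ∎

    scaleL-cong : ∀ {a b xs ys} → a ≈ b → xs ≋ₗ ys → scaleL a xs ≋ₗ scaleL b ys
    scaleL-cong {a} {b} {xs} {ys} p q = coeffwise λ i →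
      trans (coeffAt-scaleL a xs i)
            (trans (*-cong p (coeffAt-cong q i)) (sym (coeffAt-scaleL b ys i)))

    scaleL-distrib : ∀ a xs ys → scaleL a (addL xs ys) ≋ₗ addL (scaleL a xs) (scaleL a ys)
    scaleL-distrib a xs ys = coeffwise λ i → begin
      coeffAt (scaleL a (addL xs ys)) i
        ≈⟨ coeffAt-scaleL a (addL xs ys) i ⟩
      a * coeffAt (addL xs ys) i
        ≈⟨ *-congˡ (coeffAt-addL xs ys i) ⟩
      a * (coeffAt xs i + coeffAt ys i)
        ≈⟨ distribˡ _ _ _ ⟩
      a * coeffAt xs i + a * coeffAt ys i
        ≈⟨ +-cong (coeffAt-scaleL a xs i) (coeffAt-scaleL a ys i) ⟨
      coeffAt (scaleL a xs) i + coeffAt (scaleL a ys) i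
        ≈⟨ coeffAt-addL (scaleL a xs) (scaleL a ys) i ⟨
      coeffAt (addL (scaleL a xs) (scaleL a ys)) i ∎

    scaleL-comm : ∀ a b xs → scaleL a (scaleL b xs) ≋ₗ scaleL b (scaleL a xs)
    scaleL-comm a b xs = coeffwise λ i → begin
      coeffAt (scaleL a (scaleL b xs)) i
        ≈⟨ trans (coeffAt-scaleL a (scaleL b xs) i) (*-congˡ (coeffAt-scaleL b xs i)) ⟩
      a * (b * coeffAt xs i)
        ≈⟨ x∙yz≈y∙xz a b _ ⟩
      b * (a * coeffAt xs i)
        ≈⟨ trans (coeffAt-scaleL b (scaleL a xs) i) (*-congˡ (coeffAt-scaleL a xs i)) ⟨
      coeffAt (scaleL b (scaleL a xs)) i ∎
      where open CommutativeSemigroupProperties *-commutativeSemigroup using (x∙yz≈y∙xz)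

    scaleL-zeroˡ : ∀ xs → scaleL 0P xs ≋ₗ []
    scaleL-zeroˡ xs = coeffwise λ i → trans (coeffAt-scaleL 0P xs i) (zeroˡ _)

    scaleL-identityˡ : ∀ xs → scaleL 1P xs ≋ₗ xs
    scaleL-identityˡ xs = coeffwise λ i → trans (coeffAt-scaleL 1P xs i) (*-identityˡ _)

    mulL-congʳ : ∀ xs {ys ys′} → ys ≋ₗ ys′ → mulL xs ys ≋ₗ mulL xs ys′
    mulL-congʳ [] p = ≋ₗ-refl
    mulL-congʳ (x ∷ xs) p = addL-cong (scaleL-cong refl p) (∷-cong refl (mulL-congʳ xs p))

    mulL-zeroʳ : ∀ xs → mulL xs [] ≋ₗ []
    mulL-zeroʳ [] = ≋ₗ-refl
    mulL-zeroʳ (x ∷ xs) = ≋ₗ-trans (∷-cong refl (mulL-zeroʳ xs)) [0P]≋ₗ[]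

    mulL-distribˡ : ∀ xs ys zs → mulL xs (addL ys zs) ≋ₗ addL (mulL xs ys) (mulL xs zs)
    mulL-distribˡ [] ys zs = ≋ₗ-refl
    mulL-distribˡ (x ∷ xs) ys zs = ≋ₗ-trans
      (addL-cong (scaleL-distrib x ys zs) (∷-cong (sym (+-identityˡ 0P)) (mulL-distribˡ xs ys zs)))
      (addL-interchange (scaleL x ys) (scaleL x zs) (0P ∷ mulL xs ys) (0P ∷ mulL xs zs))

    mulL-scaleLʳ : ∀ xs a ys → mulL xs (scaleL a ys) ≋ₗ scaleL a (mulL xs ys)
    mulL-scaleLʳ [] a ys = ≋ₗ-refl
    mulL-scaleLʳ (x ∷ xs) a ys = ≋ₗ-trans
      (addL-cong (scaleL-comm x a ys) (∷-cong (sym (zeroʳ a)) (mulL-scaleLʳ xs a ys)))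
      (≋ₗ-sym (scaleL-distrib a (scaleL x ys) (0P ∷ mulL xs ys)))

    mulL-shiftʳ : ∀ xs ys → mulL xs (0P ∷ ys) ≋ₗ 0P ∷ mulL xs ys
    mulL-shiftʳ [] ys = ≋ₗ-sym [0P]≋ₗ[]
    mulL-shiftʳ (x ∷ xs) ys =
      ∷-cong (trans (+-identityʳ _) (zeroʳ x)) (addL-cong ≋ₗ-refl (mulL-shiftʳ xs ys))

    mulL-singletonʳ : ∀ xs a → mulL xs (a ∷ []) ≋ₗ scaleL a xs
    mulL-singletonʳ [] a = ≋ₗ-refl
    mulL-singletonʳ (x ∷ xs) a = ∷-cong (trans (+-identityʳ _) (*-comm x a)) (mulL-singletonʳ xs a)

    mulL-∷ʳ : ∀ xs y ys → mulL xs (y ∷ ys) ≋ₗ addL (scaleL y xs) (0P ∷ mulL xs ys)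
    mulL-∷ʳ xs y ys = ≋ₗ-trans (mulL-congʳ xs y∷ys≈y+0∷ys) (≋ₗ-trans
      (mulL-distribˡ xs (y ∷ []) (0P ∷ ys))
      (addL-cong (mulL-singletonʳ xs y) (mulL-shiftʳ xs ys)))
      where
      y∷ys≈y+0∷ys : y ∷ ys ≋ₗ addL (y ∷ []) (0P ∷ ys)
      y∷ys≈y+0∷ys = ∷-cong (sym (+-identityʳ y)) ≋ₗ-refl

    mulL-comm : ∀ xs ys → mulL xs ys ≋ₗ mulL ys xs
    mulL-comm [] ys = ≋ₗ-sym (mulL-zeroʳ ys)
    mulL-comm (x ∷ xs) ys = ≋ₗ-trans
      (addL-cong ≋ₗ-refl (∷-cong refl (mulL-comm xs ys)))
      (≋ₗ-sym (mulL-∷ʳ ys x xs))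

    mulL-congˡ : ∀ {xs xs′} ys → xs ≋ₗ xs′ → mulL xs ys ≋ₗ mulL xs′ ys
    mulL-congˡ {xs} {xs′} ys p =
      ≋ₗ-trans (mulL-comm xs ys) (≋ₗ-trans (mulL-congʳ ys p) (mulL-comm ys xs′))

    mulL-distribʳ : ∀ xs ys zs → mulL (addL ys zs) xs ≋ₗ addL (mulL ys xs) (mulL zs xs)
    mulL-distribʳ xs ys zs = ≋ₗ-trans (mulL-comm (addL ys zs) xs)
      (≋ₗ-trans (mulL-distribˡ xs ys zs) (addL-cong (mulL-comm xs ys) (mulL-comm xs zs)))

    mulL-scaleLˡ : ∀ a xs ys → mulL (scaleL a xs) ys ≋ₗ scaleL a (mulL xs ys)
    mulL-scaleLˡ a xs ys = ≋ₗ-trans (mulL-comm (scaleL a xs) ys)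
      (≋ₗ-trans (mulL-scaleLʳ ys a xs) (scaleL-cong refl (mulL-comm ys xs)))

    mulL-assoc : ∀ xs ys zs → mulL (mulL xs ys) zs ≋ₗ mulL xs (mulL ys zs)
    mulL-assoc [] ys zs = ≋ₗ-refl
    mulL-assoc (x ∷ xs) ys zs = ≋ₗ-trans (mulL-distribʳ zs (scaleL x ys) (0P ∷ mulL xs ys))
      (addL-cong (mulL-scaleLˡ x ys zs)
                 (addL-cong (scaleL-zeroˡ zs) (∷-cong refl (mulL-assoc xs ys zs))))

    mulL-identityˡ : ∀ xs → mulL (1P ∷ []) xs ≋ₗ xs
    mulL-identityˡ xs = ≋ₗ-trans (addL-cong (scaleL-identityˡ xs) [0P]≋ₗ[]) (addL-identityʳ xs)

    ⟨⟩-isPolynomialRing : IsPolynomialRing (suc r)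
    ⟨⟩-isPolynomialRing = record
      { isRing = record
        { +-isAbelianGroup = record
          { isGroup = record
            { isMonoid = record
              { isSemigroup = record
                { isMagma = record
                  { isEquivalence = record
                    { refl = λ { {⟨ xs ⟩} → ≋ₗ-refl {xs} }
                    ; sym = λ { {⟨ xs ⟩} {⟨ ys ⟩} → ≋ₗ-sym {xs} {ys} }
                    ; trans = λ { {⟨ xs ⟩} {⟨ ys ⟩} {⟨ zs ⟩} → ≋ₗ-trans {xs} {ys} {zs} } }
                  ; ∙-cong = λ { {⟨ xs ⟩} {⟨ xs′ ⟩} {⟨ ys ⟩} {⟨ ys′ ⟩} →
                                 addL-cong {xs} {xs′} {ys} {ys′} } }
                ; assoc = λ { ⟨ xs ⟩ ⟨ ys ⟩ ⟨ zs ⟩ → addL-assoc xs ys zs } }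
              ; identity = (λ { ⟨ xs ⟩ → addL-cong {0P ∷ []} {[]} {xs} [0P]≋ₗ[] ≋ₗ-refl })
                         , (λ { ⟨ xs ⟩ →
                                ≋ₗ-trans (addL-cong {xs} ≋ₗ-refl [0P]≋ₗ[]) (addL-identityʳ xs) }) }
            ; inverse = (λ { ⟨ xs ⟩ → negL-inverseˡ xs })
                      , (λ { ⟨ xs ⟩ → ≋ₗ-trans (addL-comm xs (negL xs)) (negL-inverseˡ xs) })
            ; ⁻¹-cong = λ { {⟨ xs ⟩} {⟨ ys ⟩} → negL-cong {xs} {ys} } }
          ; comm = λ { ⟨ xs ⟩ ⟨ ys ⟩ → addL-comm xs ys } }
        ; *-cong = λ { {⟨ xs ⟩} {⟨ xs′ ⟩} {⟨ ys ⟩} {⟨ ys′ ⟩} p q →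
                       ≋ₗ-trans (mulL-congˡ {xs} {xs′} ys p) (mulL-congʳ xs′ q) }
        ; *-assoc = λ { ⟨ xs ⟩ ⟨ ys ⟩ ⟨ zs ⟩ → mulL-assoc xs ys zs }
        ; *-identity = (λ { ⟨ xs ⟩ → mulL-identityˡ xs })
                     , (λ { ⟨ xs ⟩ → ≋ₗ-trans (mulL-comm xs (1P ∷ [])) (mulL-identityˡ xs) })
        ; distrib = (λ { ⟨ xs ⟩ ⟨ ys ⟩ ⟨ zs ⟩ → mulL-distribˡ xs ys zs })
                  , (λ { ⟨ xs ⟩ ⟨ ys ⟩ ⟨ zs ⟩ → mulL-distribʳ xs ys zs })
        }
      ; *-comm = λ { ⟨ xs ⟩ ⟨ ys ⟩ → mulL-comm xs ys } }

  isPolynomialRing : ∀ r → IsPolynomialRing r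
  isPolynomialRing zero = κ-isPolynomialRing
  isPolynomialRing (suc r) = CoefficientLists.⟨⟩-isPolynomialRing (isPolynomialRing r)

  polynomialRing : ℕ → CommutativeRing c (c ⊔ ℓ)
  polynomialRing r = toCommutativeRing (isPolynomialRing r)

  private module Ring r = CommutativeRing (polynomialRing r)

  IsZero⇒≋0P : ∀ {r} (p : Pol r) → IsZero p → p ≋ 0P
  IsZeroL⇒≋ₗ[] : ∀ {r} (xs : List (Pol r)) → IsZeroL xs → xs ≋ₗ []
  IsZero⇒≋0P (κ x) z = z
  IsZero⇒≋0P {suc r} ⟨ xs ⟩ z = ≋ₗ-trans (IsZeroL⇒≋ₗ[] xs z) (≋ₗ-sym [0P]≋ₗ[])
    where open CoefficientLists (isPolynomialRing r)
  IsZeroL⇒≋ₗ[] {r} [] _ = coeffwise λ i → Ring.refl r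
  IsZeroL⇒≋ₗ[] (x ∷ xs) (x≈0 , xs≈0) = coeffwise λ
    { zero → IsZero⇒≋0P x x≈0 ; (suc i) → coeffAt-cong (IsZeroL⇒≋ₗ[] xs xs≈0) i }

  ≋0P⇒IsZero : ∀ {r} (p : Pol r) → p ≋ 0P → IsZero p
  ≋ₗ[]⇒IsZeroL : ∀ {r} (xs : List (Pol r)) → xs ≋ₗ [] → IsZeroL xs
  ≋0P⇒IsZero (κ x) p≈0 = p≈0
  ≋0P⇒IsZero {suc r} ⟨ xs ⟩ p≈0 = ≋ₗ[]⇒IsZeroL xs (≋ₗ-trans p≈0 [0P]≋ₗ[])
    where open CoefficientLists (isPolynomialRing r)
  ≋ₗ[]⇒IsZeroL [] _ = lift _
  ≋ₗ[]⇒IsZeroL (x ∷ xs) xs≈[] =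
    ≋0P⇒IsZero x (coeffAt-cong xs≈[] zero)
    , ≋ₗ[]⇒IsZeroL xs (coeffwise λ i → coeffAt-cong xs≈[] (suc i))

  ≈P⇒≋ : ∀ {r} {p q : Pol r} → p ≈P q → p ≋ q
  ≈P⇒≋ {r} {p} {q} p-q≈0 = x∙y⁻¹≈ε⇒x≈y p q (IsZero⇒≋0P (p -P q) p-q≈0)
    where open GroupProperties (Ring.+-group r)

  ≋⇒≈P : ∀ {r} {p q : Pol r} → p ≋ q → p ≈P q
  ≋⇒≈P {r} {p} {q} p≈q = ≋0P⇒IsZero (p -P q) (x≈y⇒x∙y⁻¹≈ε p≈q)
    where open GroupProperties (Ring.+-group r)

  ≡mod-respʳ : ∀ {r} {p q q′ g : Pol r} → p ≡ q mod g → q ≋ q′ → p ≡ q′ mod g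
  ≡mod-respʳ {r} {p} {q} {q′} {g} (h , p-q≈gh) q≈q′ = h , ≋⇒≈P (begin
    p -P q′ ≈⟨ +-congˡ (-‿cong (sym q≈q′)) ⟩
    p -P q  ≈⟨ ≈P⇒≋ p-q≈gh ⟩
    g *P h  ∎)
    where open CommutativeRing (polynomialRing r)
          open SetoidReasoning setoid

module FiniteSums {c ℓ} (F : CommutativeRing c ℓ) (r : ℕ) where
  open Poly F
  open PolynomialRing F using (polynomialRing)
  open CommutativeRing (polynomialRing r) hiding (zero)
  open CommutativeSemigroupProperties +-commutativeSemigroup using (interchange)
  open CommutativeSemigroupProperties *-commutativeSemigroup using (x∙yz≈y∙xz)
  open SetoidReasoning setoid

  sumℕ-cong-< : ∀ N {g h : ℕ → Pol r} → (∀ k → k < N → g k ≈ h k) → sumℕ N g ≈ sumℕ N h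
  sumℕ-cong-< zero g≈h = refl
  sumℕ-cong-< (suc N) g≈h =
    +-cong (sumℕ-cong-< N λ k k<N → g≈h k (m<n⇒m<1+n k<N)) (g≈h N (n<1+n N))

  sumℕ-cong : ∀ N {g h : ℕ → Pol r} → (∀ k → g k ≈ h k) → sumℕ N g ≈ sumℕ N h
  sumℕ-cong N g≈h = sumℕ-cong-< N λ k _ → g≈h k

  sumℕ-distrib-+ : ∀ N (g h : ℕ → Pol r) → sumℕ N (λ k → g k + h k) ≈ sumℕ N g + sumℕ N h
  sumℕ-distrib-+ zero g h = sym (+-identityˡ 0#)
  sumℕ-distrib-+ (suc N) g h = trans (+-congʳ (sumℕ-distrib-+ N g h)) (interchange _ _ _ _)

  *-distribˡ-sumℕ : ∀ N a (g : ℕ → Pol r) → a * sumℕ N g ≈ sumℕ N (λ k → a * g k)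
  *-distribˡ-sumℕ zero a g = zeroʳ a
  *-distribˡ-sumℕ (suc N) a g = trans (distribˡ a _ _) (+-congʳ (*-distribˡ-sumℕ N a g))

  *-distribʳ-sumℕ : ∀ N a (g : ℕ → Pol r) → sumℕ N g * a ≈ sumℕ N (λ k → g k * a)
  *-distribʳ-sumℕ N a g =
    trans (*-comm _ a) (trans (*-distribˡ-sumℕ N a g) (sumℕ-cong N λ k → *-comm a (g k)))

  sumℕ-suc : ∀ N (g : ℕ → Pol r) → sumℕ (suc N) g ≈ g 0 + sumℕ N (g ∘ suc)
  sumℕ-suc zero g = +-comm 0# (g 0)
  sumℕ-suc (suc N) g = trans (+-congʳ (sumℕ-suc N g)) (+-assoc _ _ _)

  sumℕ-reverse : ∀ N (g : ℕ → Pol r) → sumℕ N g ≈ sumℕ N (λ k → g (N ∸ suc k))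
  sumℕ-reverse zero g = refl
  sumℕ-reverse (suc N) g = begin
    sumℕ N g + g N                                ≈⟨ +-congʳ (sumℕ-reverse N g) ⟩
    sumℕ N (λ k → g (N ∸ suc k)) + g N            ≈⟨ +-comm _ _ ⟩
    g N + sumℕ N (λ k → g (N ∸ suc k))            ≈⟨ sumℕ-suc N (λ k → g (suc N ∸ suc k)) ⟨
    sumℕ (suc N) (λ k → g (suc N ∸ suc k))        ∎

  -- Regroups the terms h k j (k + j < N) along the antidiagonals k + j = J.
  sumℕ-triangle : ∀ N (h : ℕ → ℕ → Pol r) →
    sumℕ N (λ k → sumℕ (N ∸ k) (h k)) ≈ sumℕ N (λ J → sumℕ (suc J) (λ α → h (J ∸ α) α))
  sumℕ-triangle zero h = refl
  sumℕ-triangle (suc N) h = begin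
    sumℕ (suc N) (λ k → sumℕ (suc N ∸ k) (h k))
      ≈⟨ sumℕ-cong-< (suc N) (λ k k≤N →
           reflexive (Eq.cong (λ M → sumℕ M (h k)) (+-∸-assoc 1 (s≤s⁻¹ k≤N)))) ⟩
    sumℕ (suc N) (λ k → sumℕ (N ∸ k) (h k) + h k (N ∸ k))
      ≈⟨ sumℕ-distrib-+ (suc N) _ _ ⟩
    (sumℕ N (λ k → sumℕ (N ∸ k) (h k)) + sumℕ (N ∸ N) (h N)) + sumℕ (suc N) (λ k → h k (N ∸ k))
      ≈⟨ +-cong (+-congˡ (reflexive (Eq.cong (λ M → sumℕ M (h N)) (n∸n≡0 N))))
                (sumℕ-reverse (suc N) _) ⟩
    (sumℕ N (λ k → sumℕ (N ∸ k) (h k)) + 0#) + sumℕ (suc N) (λ α → h (N ∸ α) (N ∸ (N ∸ α)))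
      ≈⟨ +-cong (+-identityʳ _) (sumℕ-cong-< (suc N) λ α α≤N →
           reflexive (Eq.cong (h (N ∸ α)) (m∸[m∸n]≡n (s≤s⁻¹ α≤N)))) ⟩
    sumℕ N (λ k → sumℕ (N ∸ k) (h k)) + sumℕ (suc N) (λ α → h (N ∸ α) α)
      ≈⟨ +-congʳ (sumℕ-triangle N h) ⟩
    sumℕ (suc N) (λ J → sumℕ (suc J) (λ α → h (J ∸ α) α)) ∎

  evalU-applyUpTo : ∀ M (a : ℕ → CommutativeRing.Carrier F) (x : Pol r) →
    evalU (applyUpTo a M) x ≈ sumℕ M (λ j → const (a j) * x ^P j)
  evalU-applyUpTo zero a x = refl
  evalU-applyUpTo (suc M) a x = begin
    const (a 0) + x * evalU (applyUpTo (a ∘ suc) M) x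
      ≈⟨ +-congˡ (*-congˡ (evalU-applyUpTo M (a ∘ suc) x)) ⟩
    const (a 0) + x * sumℕ M (λ j → const (a (suc j)) * x ^P j)
      ≈⟨ +-congˡ (*-distribˡ-sumℕ M x _) ⟩
    const (a 0) + sumℕ M (λ j → x * (const (a (suc j)) * x ^P j))
      ≈⟨ +-cong (*-identityʳ _) (sumℕ-cong M λ j → x∙yz≈y∙xz _ _ _) ⟨
    const (a 0) * 1# + sumℕ M (λ j → const (a (suc j)) * (x * x ^P j))
      ≈⟨ sumℕ-suc M (λ j → const (a j) * x ^P j) ⟨
    sumℕ (suc M) (λ j → const (a j) * x ^P j) ∎

module ProductsOfSums {c ℓ} (F : CommutativeRing c ℓ) (r : ℕ) where
  open Poly F
  open PolynomialRing F using (polynomialRing)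
  open FiniteSums F r using (sumℕ-suc)
  open CommutativeRing (polynomialRing r) hiding (zero)
  open CommutativeSemigroupProperties *-commutativeSemigroup using (interchange)
  open SetoidReasoning setoid

  sumFin-cong : ∀ N {g h : Fin N → Pol r} → (∀ j → g j ≈ h j) → sumFin N g ≈ sumFin N h
  sumFin-cong zero g≈h = refl
  sumFin-cong (suc N) g≈h = +-cong (g≈h Fin.zero) (sumFin-cong N (g≈h ∘ Fin.suc))

  *-distribˡ-sumFin : ∀ N a (g : Fin N → Pol r) → a * sumFin N g ≈ sumFin N (λ j → a * g j)
  *-distribˡ-sumFin zero a g = zeroʳ a
  *-distribˡ-sumFin (suc N) a g =
    trans (distribˡ a _ _) (+-congˡ (*-distribˡ-sumFin N a (g ∘ Fin.suc)))

  *-distribʳ-sumFin : ∀ N a (g : Fin N → Pol r) → sumFin N g * a ≈ sumFin N (λ j → g j * a)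
  *-distribʳ-sumFin N a g =
    trans (*-comm _ a) (trans (*-distribˡ-sumFin N a g) (sumFin-cong N λ j → *-comm a (g j)))

  sumFin-toℕ : ∀ N (g : ℕ → Pol r) → sumFin N (g ∘ toℕ) ≈ sumℕ N g
  sumFin-toℕ zero g = refl
  sumFin-toℕ (suc N) g = trans (+-congˡ (sumFin-toℕ N (g ∘ suc))) (sym (sumℕ-suc N g))

  sumTuples-cong : ∀ m n {G H : (Fin m → Fin n) → Pol r} →
    (∀ js → G js ≈ H js) → sumTuples m n G ≈ sumTuples m n H
  sumTuples-cong zero n G≈H = G≈H _
  sumTuples-cong (suc m) n G≈H = sumFin-cong n λ j → sumTuples-cong m n λ js → G≈H _

  *-distribˡ-sumTuples : ∀ m n a (G : (Fin m → Fin n) → Pol r) →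
    a * sumTuples m n G ≈ sumTuples m n (λ js → a * G js)
  *-distribˡ-sumTuples zero n a G = refl
  *-distribˡ-sumTuples (suc m) n a G =
    trans (*-distribˡ-sumFin n a _) (sumFin-cong n λ j → *-distribˡ-sumTuples m n a _)

  prodFin-cong : ∀ m {g h : Fin m → Pol r} → (∀ l → g l ≈ h l) → prodFin m g ≈ prodFin m h
  prodFin-cong zero g≈h = refl
  prodFin-cong (suc m) g≈h = *-cong (g≈h Fin.zero) (prodFin-cong m (g≈h ∘ Fin.suc))

  prodFin-distrib-* : ∀ m (g h : Fin m → Pol r) →
    prodFin m (λ l → g l * h l) ≈ prodFin m g * prodFin m h
  prodFin-distrib-* zero g h = sym (*-identityˡ 1#)
  prodFin-distrib-* (suc m) g h =
    trans (*-congˡ (prodFin-distrib-* m (g ∘ Fin.suc) (h ∘ Fin.suc))) (interchange _ _ _ _)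

  ^P-distribˡ-+-* : ∀ x a b → x ^P (a ℕ.+ b) ≈ x ^P a * x ^P b
  ^P-distribˡ-+-* x zero b = sym (*-identityˡ _)
  ^P-distribˡ-+-* x (suc a) b = trans (*-congˡ (^P-distribˡ-+-* x a b)) (sym (*-assoc _ _ _))

  prodFin-^P : ∀ m x (e : Fin m → ℕ) → prodFin m (λ l → x ^P e l) ≈ x ^P sumℕFin m e
  prodFin-^P zero x e = refl
  prodFin-^P (suc m) x e =
    trans (*-congˡ (prodFin-^P m x (e ∘ Fin.suc))) (sym (^P-distribˡ-+-* x (e Fin.zero) _))

  prodFin-sumℕ : ∀ m n (G : Fin m → ℕ → Pol r) →
    prodFin m (λ l → sumℕ n (G l)) ≈ sumTuples m n (λ js → prodFin m (λ l → G l (toℕ (js l))))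
  prodFin-sumℕ zero n G = refl
  prodFin-sumℕ (suc m) n G = begin
    sumℕ n (G Fin.zero) * prodFin m (λ l → sumℕ n (G (Fin.suc l)))
      ≈⟨ *-congˡ (prodFin-sumℕ m n (G ∘ Fin.suc)) ⟩
    sumℕ n (G Fin.zero) * rest
      ≈⟨ *-congʳ (sumFin-toℕ n (G Fin.zero)) ⟨
    sumFin n (λ j → G Fin.zero (toℕ j)) * rest
      ≈⟨ *-distribʳ-sumFin n rest _ ⟩
    sumFin n (λ j → G Fin.zero (toℕ j) * rest)
      ≈⟨ sumFin-cong n (λ j → *-distribˡ-sumTuples m n (G Fin.zero (toℕ j)) _) ⟩
    sumTuples (suc m) n (λ js → prodFin (suc m) (λ l → G l (toℕ (js l)))) ∎
    where
    rest : Pol r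
    rest = sumTuples m n (λ js → prodFin m (λ l → G (Fin.suc l) (toℕ (js l))))

module WeilOperators {c ℓ} (F : CommutativeRing c ℓ) (r : ℕ) (f : Poly.UPol F) (n : ℕ) where
  open Poly F
  open PolynomialRing F using (polynomialRing)
  open FiniteSums F r
  open ProductsOfSums F r
  open CommutativeRing (polynomialRing r) hiding (zero)
  open SetoidReasoning setoid

  -- D[ x ^ k ] is D_𝔣(x^k), and weilO₂ x y is O⁽²⁾_𝔣(x, y): Dvar f n l k is D[ var l ^ k ]
  -- and O2At f n i l is weilO₂ (var i) (var l) by definition.
  D[_^_] : Pol r → ℕ → Pol r
  D[ x ^ k ] = evalU (D-mono f n k) x

  weilO₂ : Pol r → Pol r → Pol r
  weilO₂ x y = sumℕ n (λ k → D[ x ^ k ] * y ^P k)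

  -- Σ_{j=1}^{n} a_j Σ_{α+β=j-1} x^α y^β, with the outer index shifted down by one.
  weilDiagonal : Pol r → Pol r → Pol r
  weilDiagonal x y =
    sumℕ n (λ j → const (coeff f (suc j)) * sumℕ (suc j) (λ α → x ^P α * y ^P (j ∸ α)))

  D-expand : ∀ x k →
    D[ x ^ k ] ≈ sumℕ (n ∸ k) (λ j → const (coeff f (k ℕ.+ j ℕ.+ 1)) * x ^P j)
  D-expand x k = trans (reflexive (Eq.cong (λ as → evalU as x) (map-upTo _ (n ∸ k))))
                       (evalU-applyUpTo (n ∸ k) _ x)

  weilO₂≈weilDiagonal : ∀ x y → weilO₂ x y ≈ weilDiagonal x y
  weilO₂≈weilDiagonal x y = begin
    weilO₂ x y
      ≈⟨ sumℕ-cong n (λ k → trans (*-congʳ (D-expand x k)) (*-distribʳ-sumℕ (n ∸ k) _ _)) ⟩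
    sumℕ n (λ k → sumℕ (n ∸ k) (λ j → term k j))
      ≈⟨ sumℕ-triangle n term ⟩
    sumℕ n (λ J → sumℕ (suc J) (λ α → term (J ∸ α) α))
      ≈⟨ sumℕ-cong n (λ J → trans (sumℕ-cong-< (suc J) λ α α≤J →
                                      trans (*-assoc _ _ _) (*-congʳ (coefficient J α (s≤s⁻¹ α≤J))))
                                   (sym (*-distribˡ-sumℕ (suc J) _ _))) ⟩
    weilDiagonal x y ∎
    where
    term : ℕ → ℕ → Pol r
    term k j = const (coeff f (k ℕ.+ j ℕ.+ 1)) * x ^P j * y ^P k

    coefficient : ∀ J α → α ℕ.≤ J →
      const (coeff f (J ∸ α ℕ.+ α ℕ.+ 1)) ≈ const (coeff f (suc J))
    coefficient J α α≤J = reflexive (Eq.cong (λ i → const (coeff f i))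
      (Eq.trans (Eq.cong (ℕ._+ 1) (m∸n+n≡m α≤J)) (ℕ-+-comm J 1)))

  weilDiagonal-sym : ∀ x y → weilDiagonal x y ≈ weilDiagonal y x
  weilDiagonal-sym x y = sumℕ-cong n λ J → *-congˡ (begin
    sumℕ (suc J) (λ α → x ^P α * y ^P (J ∸ α))
      ≈⟨ sumℕ-reverse (suc J) _ ⟩
    sumℕ (suc J) (λ α → x ^P (J ∸ α) * y ^P (J ∸ (J ∸ α)))
      ≈⟨ sumℕ-cong-< (suc J) (λ α α≤J →
           trans (*-comm _ _) (*-congʳ (reflexive (Eq.cong (y ^P_) (m∸[m∸n]≡n (s≤s⁻¹ α≤J)))))) ⟩
    sumℕ (suc J) (λ α → y ^P α * x ^P (J ∸ α)) ∎)

  weilO₂-sym : ∀ x y → weilO₂ x y ≈ weilO₂ y x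
  weilO₂-sym x y = begin
    weilO₂ x y       ≈⟨ weilO₂≈weilDiagonal x y ⟩
    weilDiagonal x y ≈⟨ weilDiagonal-sym x y ⟩
    weilDiagonal y x ≈⟨ weilO₂≈weilDiagonal y x ⟨
    weilO₂ y x       ∎

  weilO₂≈sum-pow*D : ∀ x y → weilO₂ x y ≈ sumℕ n (λ k → x ^P k * D[ y ^ k ])
  weilO₂≈sum-pow*D x y = trans (weilO₂-sym x y) (sumℕ-cong n λ k → *-comm D[ y ^ k ] (x ^P k))

  prodFin-weilO₂≈sumTuples-pow*D : ∀ m (x : Fin m → Pol r) y →
    prodFin m (λ l → weilO₂ (x l) y)
      ≈ sumTuples m n (λ js → prodFin m (λ l → x l ^P toℕ (js l))
                              * prodFin m (λ l → D[ y ^ toℕ (js l) ]))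
  prodFin-weilO₂≈sumTuples-pow*D m x y = begin
    prodFin m (λ l → weilO₂ (x l) y)
      ≈⟨ prodFin-cong m (λ l → weilO₂≈sum-pow*D (x l) y) ⟩
    prodFin m (λ l → sumℕ n (λ k → x l ^P k * D[ y ^ k ]))
      ≈⟨ prodFin-sumℕ m n _ ⟩
    sumTuples m n (λ js → prodFin m (λ l → x l ^P toℕ (js l) * D[ y ^ toℕ (js l) ]))
      ≈⟨ sumTuples-cong m n (λ js → prodFin-distrib-* m _ _) ⟩
    sumTuples m n (λ js → prodFin m (λ l → x l ^P toℕ (js l))
                          * prodFin m (λ l → D[ y ^ toℕ (js l) ])) ∎

  prodFin-weilO₂≈sumTuples-D*pow : ∀ m (x : Fin m → Pol r) y →
    prodFin m (λ l → weilO₂ (x l) y)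
      ≈ sumTuples m n (λ js → prodFin m (λ l → D[ x l ^ toℕ (js l) ])
                              * y ^P sumℕFin m (λ l → toℕ (js l)))
  prodFin-weilO₂≈sumTuples-D*pow m x y = begin
    prodFin m (λ l → weilO₂ (x l) y)
      ≈⟨ prodFin-sumℕ m n _ ⟩
    sumTuples m n (λ js → prodFin m (λ l → D[ x l ^ toℕ (js l) ] * y ^P toℕ (js l)))
      ≈⟨ sumTuples-cong m n (λ js →
           trans (prodFin-distrib-* m _ _) (*-congˡ (prodFin-^P m y (λ l → toℕ (js l))))) ⟩
    sumTuples m n (λ js → prodFin m (λ l → D[ x l ^ toℕ (js l) ])
                          * y ^P sumℕFin m (λ l → toℕ (js l))) ∎

proposition2p5 : {c ℓ : Level} (F : CommutativeRing c ℓ) → IsFiniteField F →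
  let open Poly F in
  (n : ℕ) → 1 ≤ n → (f : UPol) → IsMonicOfDegree f n →
  -- rank two, in F[X₁,X₂]
  (O2At {2} f n Fin.zero (Fin.suc Fin.zero)
     ≈P sumℕ n (λ j′ → const (coeff f (suc j′)) *P
          sumℕ (suc j′) (λ α → (var Fin.zero ^P α) *P (var (Fin.suc Fin.zero) ^P (j′ ∸ α))))
  × O2At {2} f n Fin.zero (Fin.suc Fin.zero)
     ≈P sumℕ n (λ k → (var Fin.zero ^P k) *P Dvar f n (Fin.suc Fin.zero) k))
  ×
  -- general rank r = suc m ≥ 2, in F[X₁,…,X_r]; X_l = var (inject₁ l), X_r = var (fromℕ m)
  ((m : ℕ) → 1 ≤ m → (O : Pol (suc m)) →
    ((i : Fin (suc m)) → DegLt i n O) →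
    O ≡ prodFin m (λ j → O2At f n (inject₁ j) (fromℕ m)) mod evalU f (var (fromℕ m)) →
    (O ≡ sumTuples m n (λ js →
            prodFin m (λ l → var (inject₁ l) ^P toℕ (js l))
            *P prodFin m (λ l → Dvar f n (fromℕ m) (toℕ (js l))))
       mod evalU f (var (fromℕ m)))
    × (O ≡ sumTuples m n (λ js →
            prodFin m (λ l → Dvar f n (inject₁ l) (toℕ (js l)))
            *P (var (fromℕ m) ^P sumℕFin m (λ l → toℕ (js l))))
       mod evalU f (var (fromℕ m))))
proposition2p5 F _ n _ f _ =
    (≋⇒≈P (W.weilO₂≈weilDiagonal 2 X₁ X₂) , ≋⇒≈P (W.weilO₂≈sum-pow*D 2 X₁ X₂))
  , λ m _ O _ O≡∏ →
      ≡mod-respʳ {p = O} {g = 𝔣 m} O≡∏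
        (W.prodFin-weilO₂≈sumTuples-pow*D (suc m) m (var ∘ inject₁) (var (fromℕ m)))
    , ≡mod-respʳ {p = O} {g = 𝔣 m} O≡∏
        (W.prodFin-weilO₂≈sumTuples-D*pow (suc m) m (var ∘ inject₁) (var (fromℕ m)))
  where
  open Poly F
  open PolynomialRing F using (≋⇒≈P; ≡mod-respʳ)
  module W r = WeilOperators F r f n

  X₁ X₂ : Pol 2
  X₁ = var Fin.zero
  X₂ = var (Fin.suc Fin.zero)

  𝔣 : (m : ℕ) → Pol (suc m)
  𝔣 m = evalU f (var (fromℕ m))
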